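{- Let $G$ be a disconnected graph with $k \geq 2$ connected components, at least two of which are nontrivial (have at least two vertices). Then $h(G\overline{G}) = k+1$.
   Context: All graphs are finite, simple and undirected. For a graph $H$ and $x,y \in V(H)$, the closed interval $I[x,y]$ consists of $x$, $y$ and all vertices lying on some shortest path between $x$ and $y$ in $H$; for $S \subseteq V(H)$, $I[S] = \bigcup_{x,y\in S} I[x,y]$. A set $S$ is (geodetically) convex if $I[S]=S$; the convex hull $H(S)$ is the smallest convex set containing $S$; $S$ is a hull set if $H(S)=V(H)$; the (geodetic) hull number $h(H)$ is the minimum cardinality of a hull set of $H$. For a graph $G$ with vertex set $\{v_1,\dots,v_n\}$, the complementary prism $G\overline{G}$ has vertex set $\{v_1,\dots,v_n\}\cup\{\overline{v}_1,\dots,\overline{v}_n\}$ and edge set $E(G) \cup \{\overline{v}_i\overline{v}_j : i<j,\ v_iv_j\notin E(G)\} \cup \{v_i\overline{v}_i : 1\le i\le n\}$. A component is trivial if it has exactly one vertex, nontrivial otherwise. -}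

module Defs where

open import Data.Nat using (ℕ; zero; suc; _+_; _≤_)
open import Data.Fin using (Fin; splitAt; _≟_)
open import Data.Fin.Subset using (Subset; _∈_; _⊆_; ∣_∣)
open import Data.Bool using (Bool; true; false; not; _∧_)
open import Data.Sum using (_⊎_; inj₁; inj₂)
open import Data.Product using (Σ; _×_; ∃; ∃-syntax)
open import Relation.Nullary using (¬_)
open import Relation.Nullary.Decidable using (⌊_⌋)
open import Relation.Binary.PropositionalEquality using (_≡_)

Adjacency : ℕ → Set
Adjacency m = Fin m → Fin m → Bool

record SimpleGraph (n : ℕ) : Set where
  field
    adj    : Adjacency n
    sym    : ∀ x y → adj x y ≡ adj y x
    irrefl : ∀ x → adj x x ≡ false
open SimpleGraph public

complAdj : ∀ {n} → SimpleGraph n → Adjacency n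
complAdj G x y = not (adj G x y) ∧ not ⌊ x ≟ y ⌋

-- Complementary prism G Ḡ on Fin (n + n): first copy = vertices v_i of G,
-- second copy = vertices v̄_i of Ḡ (via splitAt).
prismAdj : ∀ {n} → SimpleGraph n → Adjacency (n + n)
prismAdj {n} G u v with splitAt n u | splitAt n v
... | inj₁ a | inj₁ b = adj G a b
... | inj₂ a | inj₂ b = complAdj G a b
... | inj₁ a | inj₂ b = ⌊ a ≟ b ⌋
... | inj₂ a | inj₁ b = ⌊ a ≟ b ⌋

module _ {m : ℕ} (A : Adjacency m) where

  data Walk : Fin m → Fin m → ℕ → Set where
    nil  : ∀ {x} → Walk x x 0
    cons : ∀ {x y z ℓ} → A x y ≡ true → Walk y z ℓ → Walk x z (suc ℓ)

  data OnWalk (v : Fin m) : ∀ {x y ℓ} → Walk x y ℓ → Set where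
    onStart : ∀ {y ℓ} (w : Walk v y ℓ) → OnWalk v w
    onRest  : ∀ {x y z ℓ} (e : A x y ≡ true) {w : Walk y z ℓ} →
              OnWalk v w → OnWalk v (cons e w)

  IsShortest : ∀ {x y ℓ} → Walk x y ℓ → Set
  IsShortest {x} {y} {ℓ} _ = ∀ ℓ' → Walk x y ℓ' → ℓ ≤ ℓ'

  InInterval : Fin m → Fin m → Fin m → Set
  InInterval x y z =
    z ≡ x ⊎ z ≡ y ⊎
    (Σ ℕ λ ℓ → Σ (Walk x y ℓ) λ w → IsShortest w × OnWalk z w)

  -- S convex : I[S] = S  (i.e. I[S] ⊆ S, the reverse inclusion is automatic)
  Convex : Subset m → Set
  Convex S = ∀ x y z → x ∈ S → y ∈ S → InInterval x y z → z ∈ S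

  InHull : Subset m → Fin m → Set
  InHull S z = ∀ (C : Subset m) → S ⊆ C → Convex C → z ∈ C

  IsHullSet : Subset m → Set
  IsHullSet S = ∀ z → InHull S z

  HullNumber : ℕ → Set
  HullNumber h = (Σ (Subset m) λ S → IsHullSet S × ∣ S ∣ ≡ h)
               × (∀ S → IsHullSet S → h ≤ ∣ S ∣)

  Reachable : Fin m → Fin m → Set
  Reachable x y = ∃[ ℓ ] Walk x y ℓ

  -- c labels the connected components by Fin k: surjective, and two vertices
  -- get the same label iff they are joined by a walk.
  -- So the graph has exactly k components.
  IsComponentLabelling : ∀ {k} → (Fin m → Fin k) → Set
  IsComponentLabelling {k} c =
    (∀ (i : Fin k) → ∃[ x ] c x ≡ i) ×
    (∀ x y → (c x ≡ c y → Reachable x y) × (Reachable x y → c x ≡ c y))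

  NontrivialComponent : ∀ {k} → (Fin m → Fin k) → Fin k → Set
  NontrivialComponent c i = ∃[ x ] ∃[ y ] (¬ x ≡ y × c x ≡ i × c y ≡ i)

-- Write vtx a for the
-- vertex a of G and bar a for its copy ā in Ḡ.  Distances in GḠ are small:
-- d(vtx p, vtx q) ≤ 3 and all other distances are ≤ 2 (for adjacent p, q of G,
-- a vertex of another component gives bar p and bar q a common neighbour).  Vertices of G in
-- different components are at distance at least 3, read off from a
-- 1-Lipschitz "level" function.  Comparing such upper and lower bounds decides
-- which vertices may lie on a geodesic (lemma off-geodesic), which is all the
-- convexity reasoning needs.
--
-- Upper bound: S₀ = {one vertex of G per component} ∪ {a neighbour w₁ of the
-- representative of a nontrivial component}.  Any convex C ⊇ S₀ contains the
-- bars of both ends of an edge, hence all bars outside that component; via the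
-- second nontrivial component all of Ḡ; and then all of G along walks.
-- Lower bound: a hull set meets every component of G, since the set of all
-- vertices except one G-component is convex; and it cannot consist of
-- exactly one vertex per component, since the set U of those vertices together
-- with their bars is convex but misses a vertex of a nontrivial component.
module Submission where

open import Defs hiding (sym)
open import Data.Nat using (ℕ; zero; suc; _+_; _≤_; _<_; z≤n; s≤s; _≤?_)
open import Data.Nat.Properties
  using (≤-refl; ≤-reflexive; ≤-trans; ≤-antisym; +-mono-≤; +-monoʳ-≤; +-suc; +-identityʳ; n≤1+n; <⇒≱; module ≤-Reasoning)
open import Data.Fin using (Fin; zero; suc; splitAt; _≟_; _↑ˡ_; _↑ʳ_)
open import Data.Fin.Properties
  using (splitAt-↑ˡ; splitAt-↑ʳ; splitAt⁻¹-↑ˡ; splitAt⁻¹-↑ʳ; ↑ˡ-injective; ↑ʳ-injective; suc-injective; any?)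
open import Data.Fin.Subset using (Subset; _∈_; _∉_; _⊆_; ∣_∣; ⁅_⁆; _∪_; _-_; inside; outside) renaming (⊥ to ∅)
open import Data.Fin.Subset.Properties
  using (_∈?_; x∈p∪q⁺; x∈⁅x⁆; ∣p∣≤∣x∷p∣; ∣⊥∣≡0; ∣⁅x⁆∣≡1; x∈p∧x≢y⇒x∈p-y; x∈p⇒∣p-x∣<∣p∣)
open import Data.Vec using ([]; _∷_; tabulate)
open import Data.Vec.Properties using ([]=⇒lookup; lookup⇒[]=; lookup∘tabulate)
open import Data.Bool using (Bool; true; false; if_then_else_)
open import Data.Bool.Properties using (T-≡)
open import Data.Sum using (inj₁; inj₂; [_,_]′)
open import Data.Product using (Σ; _×_; _,_; ∃-syntax; ∃₂; proj₁; proj₂)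
open import Data.Unit using (⊤; tt)
open import Data.Empty using (⊥; ⊥-elim)
open import Function using (_∘_; Injective)
open import Function.Bundles using (Equivalence)
open import Relation.Unary using (Decidable)
open import Relation.Nullary using (¬_; yes; no; does)
open import Relation.Nullary.Decidable using (dec-true; dec-false; ⌊_⌋; True; toWitness; fromWitness; _×-dec_; ¬?)
open import Relation.Binary.PropositionalEquality using (_≡_; _≢_; refl; sym; trans; cong; subst; ≢-sym)

by-computation : ∀ {a b} {a≤b : True (a ≤? b)} → a ≤ b
by-computation {a≤b = a≤b} = toWitness a≤b

⌊≟⌋-refl : ∀ {N} (a : Fin N) → ⌊ a ≟ a ⌋ ≡ true
⌊≟⌋-refl a with a ≟ a
... | yes _ = refl
... | no a≢a = ⊥-elim (a≢a refl)

⌊≟⌋-false : ∀ {N} {a b : Fin N} → a ≢ b → ⌊ a ≟ b ⌋ ≡ false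
⌊≟⌋-false {a = a} {b} a≢b with a ≟ b
... | yes a≡b = ⊥-elim (a≢b a≡b)
... | no _ = refl

⌊≟⌋-sound : ∀ {N} {a b : Fin N} → ⌊ a ≟ b ⌋ ≡ true → a ≡ b
⌊≟⌋-sound {a = a} {b} _ with a ≟ b
⌊≟⌋-sound _ | yes a≡b = a≡b

∈-tabulate⁺ : ∀ {m} (f : Fin m → Bool) {x : Fin m} → f x ≡ true → x ∈ tabulate f
∈-tabulate⁺ f {x} fx = lookup⇒[]= x (tabulate f) (trans (lookup∘tabulate f x) fx)

∈-tabulate⁻ : ∀ {m} (f : Fin m → Bool) {x : Fin m} → x ∈ tabulate f → f x ≡ true
∈-tabulate⁻ f {x} x∈ = trans (sym (lookup∘tabulate f x)) ([]=⇒lookup x∈)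

image : ∀ {k m} → (Fin k → Fin m) → Subset m
image {zero}  g = ∅
image {suc k} g = ⁅ g zero ⁆ ∪ image (g ∘ suc)

∈-image : ∀ {k m} (g : Fin k → Fin m) (i : Fin k) → g i ∈ image g
∈-image g zero    = x∈p∪q⁺ (inj₁ (x∈⁅x⁆ (g zero)))
∈-image g (suc i) = x∈p∪q⁺ {p = ⁅ g zero ⁆} (inj₂ (∈-image (g ∘ suc) i))

∣p∪q∣≤∣p∣+∣q∣ : ∀ {m} (p q : Subset m) → ∣ p ∪ q ∣ ≤ ∣ p ∣ + ∣ q ∣
∣p∪q∣≤∣p∣+∣q∣ []            []            = z≤n
∣p∪q∣≤∣p∣+∣q∣ (outside ∷ p) (outside ∷ q) = ∣p∪q∣≤∣p∣+∣q∣ p q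
∣p∪q∣≤∣p∣+∣q∣ (outside ∷ p) (inside ∷ q)  =
  ≤-trans (s≤s (∣p∪q∣≤∣p∣+∣q∣ p q)) (≤-reflexive (sym (+-suc ∣ p ∣ ∣ q ∣)))
∣p∪q∣≤∣p∣+∣q∣ (inside ∷ p)  (x ∷ q)       =
  s≤s (≤-trans (∣p∪q∣≤∣p∣+∣q∣ p q) (+-monoʳ-≤ ∣ p ∣ (∣p∣≤∣x∷p∣ x q)))

∣image∣≤ : ∀ {k m} (g : Fin k → Fin m) → ∣ image g ∣ ≤ k
∣image∣≤ {zero}  {m} g = ≤-reflexive (∣⊥∣≡0 m)
∣image∣≤ {suc k}     g = begin
  ∣ ⁅ g zero ⁆ ∪ image (g ∘ suc) ∣      ≤⟨ ∣p∪q∣≤∣p∣+∣q∣ ⁅ g zero ⁆ (image (g ∘ suc)) ⟩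
  ∣ ⁅ g zero ⁆ ∣ + ∣ image (g ∘ suc) ∣  ≡⟨ cong (_+ ∣ image (g ∘ suc) ∣) (∣⁅x⁆∣≡1 (g zero)) ⟩
  suc ∣ image (g ∘ suc) ∣               ≤⟨ s≤s (∣image∣≤ (g ∘ suc)) ⟩
  suc k                                 ∎
  where open ≤-Reasoning

injective⇒≤∣∣ : ∀ {k m} (f : Fin k → Fin m) → Injective _≡_ _≡_ f →
                (S : Subset m) → (∀ i → f i ∈ S) → k ≤ ∣ S ∣
injective⇒≤∣∣ {zero}  f f-inj S f∈S = z≤n
injective⇒≤∣∣ {suc k} f f-inj S f∈S =
  ≤-trans (s≤s (injective⇒≤∣∣ (f ∘ suc) (suc-injective ∘ f-inj) (S - f zero) rest∈))
          (x∈p⇒∣p-x∣<∣p∣ (f∈S zero))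
  where
    rest∈ : ∀ i → f (suc i) ∈ S - f zero
    rest∈ i = x∈p∧x≢y⇒x∈p-y (f∈S (suc i)) (λ eq → zero≢suc (f-inj eq))
      where zero≢suc : ∀ {j : Fin k} → Fin.suc j ≢ zero
            zero≢suc ()

another-label : ∀ {k} → 2 ≤ k → (i : Fin k) → ∃[ j ] j ≢ i
another-label {suc (suc _)} _ zero    = suc zero , λ ()
another-label {suc (suc _)} _ (suc _) = zero , λ ()
another-label {suc zero} (s≤s ()) zero

module Geodesics {m : ℕ} (A : Adjacency m) where

  DistAtLeast : Fin m → Fin m → ℕ → Set
  DistAtLeast x y s = ∀ ℓ → Walk A x y ℓ → s ≤ ℓ

  DistAtMost : Fin m → Fin m → ℕ → Set
  DistAtMost x y s = ∃[ ℓ ] ℓ ≤ s × Walk A x y ℓ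

  OnGeodesic : Fin m → Fin m → Fin m → Set
  OnGeodesic x y z = Σ ℕ λ ℓ → Σ (Walk A x y ℓ) λ w → IsShortest A w × OnWalk A z w

  split-at : ∀ {x y z ℓ} {w : Walk A x y ℓ} → OnWalk A z w →
             ∃₂ λ a b → Walk A x z a × Walk A z y b × a + b ≡ ℓ
  split-at (onStart w) = 0 , _ , nil , w , refl
  split-at (onRest e z∈w) with split-at z∈w
  ... | a , b , w₁ , w₂ , a+b≡ℓ = suc a , b , cons e w₁ , w₂ , cong suc a+b≡ℓ

  -- On a geodesic d(x,z) + d(z,y) ≤ d(x,y); so z is excluded from every
  -- x–y geodesic as soon as lower bounds for d(x,z), d(z,y) exceed an upper
  -- bound for d(x,y).
  off-geodesic : ∀ {x y z B s t} → OnGeodesic x y z → DistAtMost x y B →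
                 DistAtLeast x z s → DistAtLeast z y t → B < s + t → ⊥
  off-geodesic {B = B} {s} {t} (ℓ , _ , shortest , z∈w) (L , L≤B , w′) dxz dzy B<s+t
    with split-at z∈w
  ... | a , b , wxz , wzy , a+b≡ℓ = <⇒≱ B<s+t (begin
    s + t  ≤⟨ +-mono-≤ (dxz a wxz) (dzy b wzy) ⟩
    a + b  ≡⟨ a+b≡ℓ ⟩
    ℓ      ≤⟨ shortest L w′ ⟩
    L      ≤⟨ L≤B ⟩
    B      ∎)
    where open ≤-Reasoning

  dist≥1 : ∀ {x y} → x ≢ y → DistAtLeast x y 1
  dist≥1 x≢y _ nil        = ⊥-elim (x≢y refl)
  dist≥1 _   _ (cons _ _) = s≤s z≤n

  dist≥2 : ∀ {x y} → x ≢ y → A x y ≡ false → DistAtLeast x y 2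
  dist≥2 x≢y _      _ nil                 = ⊥-elim (x≢y refl)
  dist≥2 _   nonadj _ (cons edge nil)     = ⊥-elim (true≢false (trans (sym edge) nonadj))
    where true≢false : true ≢ false
          true≢false ()
  dist≥2 _   _      _ (cons _ (cons _ _)) = s≤s (s≤s z≤n)

  trivial-geodesic : ∀ {x z} → OnGeodesic x x z → z ≡ x
  trivial-geodesic {x} {z} geo with z ≟ x
  ... | yes z≡x = z≡x
  ... | no z≢x  = ⊥-elim (off-geodesic {B = 0} {1} {1} geo (0 , z≤n , nil)
                                      (dist≥1 (≢-sym z≢x)) (dist≥1 z≢x) by-computation)

  geodesically-closed⇒convex : (C : Subset m) →
    (∀ {x y z} → x ∈ C → y ∈ C → OnGeodesic x y z → z ∈ C) → Convex A C
  geodesically-closed⇒convex C closed x y z x∈C y∈C (inj₁ refl)        = x∈C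
  geodesically-closed⇒convex C closed x y z x∈C y∈C (inj₂ (inj₁ refl)) = y∈C
  geodesically-closed⇒convex C closed x y z x∈C y∈C (inj₂ (inj₂ geo))  = closed x∈C y∈C geo

  convex-∋-geodesic : ∀ {C x y z ℓ} → Convex A C → x ∈ C → y ∈ C →
                      (w : Walk A x y ℓ) → DistAtLeast x y ℓ → OnWalk A z w → z ∈ C
  convex-∋-geodesic {x = x} {y} {z} {ℓ} convex x∈C y∈C w shortest z∈w =
    convex x y z x∈C y∈C (inj₂ (inj₂ (ℓ , w , shortest , z∈w)))

  Lipschitz : (Fin m → ℕ) → Set
  Lipschitz f = ∀ {x y} → A x y ≡ true → f y ≤ suc (f x)

  lipschitz-walk : ∀ {f} → Lipschitz f → ∀ {x y ℓ} → Walk A x y ℓ → f y ≤ ℓ + f x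
  lipschitz-walk lip nil = ≤-refl
  lipschitz-walk {f} lip (cons {x} {y} {z} {ℓ} edge w) = begin
    f z            ≤⟨ lipschitz-walk lip w ⟩
    ℓ + f y        ≤⟨ +-monoʳ-≤ ℓ (lip edge) ⟩
    ℓ + suc (f x)  ≡⟨ +-suc ℓ (f x) ⟩
    suc ℓ + f x    ∎
    where open ≤-Reasoning

  lipschitz-dist : ∀ {f} → Lipschitz f → ∀ {x y} → f x ≡ 0 → DistAtLeast x y (f y)
  lipschitz-dist {f} lip {x} {y} fx≡0 ℓ w =
    subst (f y ≤_) (trans (cong (ℓ +_) fx≡0) (+-identityʳ ℓ)) (lipschitz-walk lip w)

module Components {n : ℕ} (G : SimpleGraph n) {k : ℕ} (c : Fin n → Fin k)
                  (labelling : IsComponentLabelling (adj G) c) where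

  adjacent⇒same : ∀ {a b} → adj G a b ≡ true → c a ≡ c b
  adjacent⇒same edge = proj₂ (proj₂ labelling _ _) (1 , cons edge nil)

  different⇒nonadjacent : ∀ {a b} → c a ≢ c b → adj G a b ≡ false
  different⇒nonadjacent {a} {b} ca≢cb with adj G a b in eq
  ... | true  = ⊥-elim (ca≢cb (adjacent⇒same eq))
  ... | false = refl

  different⇒distinct : ∀ {a b} → c a ≢ c b → a ≢ b
  different⇒distinct ca≢cb refl = ca≢cb refl

  adjacent⇒distinct : ∀ {a b} → adj G a b ≡ true → a ≢ b
  adjacent⇒distinct {a} edge refl with trans (sym edge) (irrefl G a)
  ... | ()

  labels-differ : ∀ {a b i j} → c a ≡ i → c b ≡ j → i ≢ j → c a ≢ c b
  labels-differ refl refl i≢j = i≢j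

  rep : Fin k → Fin n
  rep j = proj₁ (proj₁ labelling j)

  rep-label : ∀ j → c (rep j) ≡ j
  rep-label j = proj₂ (proj₁ labelling j)

  walk-from-rep : ∀ v → ∃[ ℓ ] Walk (adj G) (rep (c v)) v ℓ
  walk-from-rep v = proj₁ (proj₂ labelling (rep (c v)) v) (rep-label (c v))

  first-edge : ∀ {a b ℓ} → a ≢ b → Walk (adj G) a b ℓ → ∃[ w ] adj G a w ≡ true
  first-edge a≢b nil           = ⊥-elim (a≢b refl)
  first-edge _   (cons edge _) = _ , edge

  walk-between : ∀ {a b} → c a ≡ c b → ∃[ ℓ ] Walk (adj G) a b ℓ
  walk-between = proj₁ (proj₂ labelling _ _)

  neighbour-label : ∀ {i w} → adj G (rep i) w ≡ true → c w ≡ i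
  neighbour-label {i} edge = trans (sym (adjacent⇒same edge)) (rep-label i)

  rep-neighbour : ∀ {i} → NontrivialComponent (adj G) c i → ∃[ w ] adj G (rep i) w ≡ true
  rep-neighbour {i} (x , y , x≢y , cx≡i , cy≡i) with rep i ≟ x
  ... | yes refl = first-edge x≢y (proj₂ (walk-between (trans (rep-label i) (sym cy≡i))))
  ... | no r≢x   = first-edge r≢x (proj₂ (walk-between (trans (rep-label i) (sym cx≡i))))

module Prism {n : ℕ} (G : SimpleGraph n) where

  A : Adjacency (n + n)
  A = prismAdj G

  open Geodesics A public

  vtx bar : Fin n → Fin (n + n)
  vtx a = a ↑ˡ n
  bar a = n ↑ʳ a

  data View : Fin (n + n) → Set where
    vtx-view : ∀ a → View (vtx a)
    bar-view : ∀ a → View (bar a)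

  view : ∀ u → View u
  view u with splitAt n u in eq
  ... | inj₁ a = subst View (splitAt⁻¹-↑ˡ eq) (vtx-view a)
  ... | inj₂ a = subst View (splitAt⁻¹-↑ʳ eq) (bar-view a)

  vtx≢bar : ∀ {a b} → vtx a ≢ bar b
  vtx≢bar {a} {b} eq with trans (sym (splitAt-↑ˡ n a n)) (trans (cong (splitAt n) eq) (splitAt-↑ʳ n n b))
  ... | ()

  vtx-injective : ∀ {a b} → vtx a ≡ vtx b → a ≡ b
  vtx-injective = ↑ˡ-injective n _ _

  bar-injective : ∀ {a b} → bar a ≡ bar b → a ≡ b
  bar-injective = ↑ʳ-injective n _ _

  vtx-≢ : ∀ {a b} → a ≢ b → vtx a ≢ vtx b
  vtx-≢ a≢b = a≢b ∘ vtx-injective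

  bar-≢ : ∀ {a b} → a ≢ b → bar a ≢ bar b
  bar-≢ a≢b = a≢b ∘ bar-injective

  A-vtx-vtx : ∀ a b → A (vtx a) (vtx b) ≡ adj G a b
  A-vtx-vtx a b rewrite splitAt-↑ˡ n a n | splitAt-↑ˡ n b n = refl

  A-bar-bar : ∀ a b → A (bar a) (bar b) ≡ complAdj G a b
  A-bar-bar a b rewrite splitAt-↑ʳ n n a | splitAt-↑ʳ n n b = refl

  A-vtx-bar : ∀ a b → A (vtx a) (bar b) ≡ ⌊ a ≟ b ⌋
  A-vtx-bar a b rewrite splitAt-↑ˡ n a n | splitAt-↑ʳ n n b = refl

  A-bar-vtx : ∀ a b → A (bar a) (vtx b) ≡ ⌊ a ≟ b ⌋
  A-bar-vtx a b rewrite splitAt-↑ʳ n n a | splitAt-↑ˡ n b n = refl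

  rung : ∀ a → A (vtx a) (bar a) ≡ true
  rung a = trans (A-vtx-bar a a) (⌊≟⌋-refl a)

  rung⁻ : ∀ a → A (bar a) (vtx a) ≡ true
  rung⁻ a = trans (A-bar-vtx a a) (⌊≟⌋-refl a)

  vtx-edge : ∀ {a b} → adj G a b ≡ true → A (vtx a) (vtx b) ≡ true
  vtx-edge {a} {b} = trans (A-vtx-vtx a b)

  bar-edge : ∀ {a b} → adj G a b ≡ false → a ≢ b → A (bar a) (bar b) ≡ true
  bar-edge {a} {b} nonadj a≢b rewrite A-bar-bar a b | nonadj | ⌊≟⌋-false a≢b = refl

  no-bar-edge : ∀ {a b} → adj G a b ≡ true → A (bar a) (bar b) ≡ false
  no-bar-edge {a} {b} edge rewrite A-bar-bar a b | edge = refl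

  no-vtx-bar : ∀ {a b} → a ≢ b → A (vtx a) (bar b) ≡ false
  no-vtx-bar {a} {b} a≢b = trans (A-vtx-bar a b) (⌊≟⌋-false a≢b)

  no-bar-vtx : ∀ {a b} → a ≢ b → A (bar a) (vtx b) ≡ false
  no-bar-vtx {a} {b} a≢b = trans (A-bar-vtx a b) (⌊≟⌋-false a≢b)

  -- Distance upper bounds valid in every complementary prism: a G-vertex
  -- reaches any other vertex through its own bar unless it is adjacent to it.
  dist-vtx-vtx≤3 : ∀ p q → DistAtMost (vtx p) (vtx q) 3
  dist-vtx-vtx≤3 p q with p ≟ q
  ... | yes refl = 0 , z≤n , nil
  ... | no p≢q with adj G p q in pq
  ...   | true  = 1 , by-computation , cons (vtx-edge pq) nil
  ...   | false = 3 , ≤-refl , cons (rung p) (cons (bar-edge pq p≢q) (cons (rung⁻ q) nil))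

  dist-vtx-bar≤2 : ∀ p q → DistAtMost (vtx p) (bar q) 2
  dist-vtx-bar≤2 p q with p ≟ q
  ... | yes refl = 1 , by-computation , cons (rung p) nil
  ... | no p≢q with adj G p q in pq
  ...   | true  = 2 , ≤-refl , cons (vtx-edge pq) (cons (rung q) nil)
  ...   | false = 2 , ≤-refl , cons (rung p) (cons (bar-edge pq p≢q) nil)

  dist-bar-vtx≤2 : ∀ p q → DistAtMost (bar p) (vtx q) 2
  dist-bar-vtx≤2 p q with p ≟ q
  ... | yes refl = 1 , by-computation , cons (rung⁻ p) nil
  ... | no p≢q with adj G p q in pq
  ...   | true  = 2 , ≤-refl , cons (rung⁻ p) (cons (vtx-edge pq) nil)
  ...   | false = 2 , ≤-refl , cons (bar-edge pq p≢q) (cons (rung⁻ q) nil)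

  prismSet : ∀ {P Q : Fin n → Set} → Decidable P → Decidable Q → Subset (n + n)
  prismSet P? Q? = tabulate λ u → [ ⌊_⌋ ∘ P? , ⌊_⌋ ∘ Q? ]′ (splitAt n u)

  module _ {P Q : Fin n → Set} (P? : Decidable P) (Q? : Decidable Q) where

    vtx∈⁺ : ∀ {a} → P a → vtx a ∈ prismSet P? Q?
    vtx∈⁺ {a} pa = ∈-tabulate⁺ _ (trans (cong [ ⌊_⌋ ∘ P? , ⌊_⌋ ∘ Q? ]′ (splitAt-↑ˡ n a n))
                                        (Equivalence.to T-≡ (fromWitness pa)))

    vtx∈⁻ : ∀ {a} → vtx a ∈ prismSet P? Q? → P a
    vtx∈⁻ {a} a∈ = toWitness (Equivalence.from T-≡
      (trans (sym (cong [ ⌊_⌋ ∘ P? , ⌊_⌋ ∘ Q? ]′ (splitAt-↑ˡ n a n))) (∈-tabulate⁻ _ a∈)))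

    bar∈⁺ : ∀ {a} → Q a → bar a ∈ prismSet P? Q?
    bar∈⁺ {a} qa = ∈-tabulate⁺ _ (trans (cong [ ⌊_⌋ ∘ P? , ⌊_⌋ ∘ Q? ]′ (splitAt-↑ʳ n n a))
                                        (Equivalence.to T-≡ (fromWitness qa)))

    bar∈⁻ : ∀ {a} → bar a ∈ prismSet P? Q? → Q a
    bar∈⁻ {a} a∈ = toWitness (Equivalence.from T-≡
      (trans (sym (cong [ ⌊_⌋ ∘ P? , ⌊_⌋ ∘ Q? ]′ (splitAt-↑ʳ n n a))) (∈-tabulate⁻ _ a∈)))

module Disconnected {n : ℕ} (G : SimpleGraph n) {k : ℕ} (c : Fin n → Fin k)
                    (labelling : IsComponentLabelling (adj G) c) (two-components : 2 ≤ k) where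

  open Prism G public
  open Components G c labelling public

  foreign-vertex : ∀ a → ∃[ r ] c r ≢ c a
  foreign-vertex a with another-label two-components (c a)
  ... | j , j≢ca = rep j , λ crj≡ca → j≢ca (trans (sym (rep-label j)) crj≡ca)

  bar-edge-across : ∀ {a b} → c a ≢ c b → A (bar a) (bar b) ≡ true
  bar-edge-across ca≢cb = bar-edge (different⇒nonadjacent ca≢cb) (different⇒distinct ca≢cb)

  -- Adjacent vertices of G have a common Ḡ-neighbour in another component.
  dist-bar-bar≤2 : ∀ p q → DistAtMost (bar p) (bar q) 2
  dist-bar-bar≤2 p q with p ≟ q
  ... | yes refl = 0 , z≤n , nil
  ... | no p≢q with adj G p q in pq
  ...   | false = 1 , by-computation , cons (bar-edge pq p≢q) nil
  ...   | true with foreign-vertex p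
  ...     | r , cr≢cp = 2 , ≤-refl , cons (bar-edge-across (≢-sym cr≢cp)) (cons (bar-edge-across cr≢cq) nil)
    where cr≢cq : c r ≢ c q
          cr≢cq cr≡cq = cr≢cp (trans cr≡cq (sym (adjacent⇒same pq)))

  -- The level of a vertex with respect to component j is its distance from
  -- the G-copy of that component: 0 on it, 1 on its bars, 2 on the other
  -- bars, 3 on the other G-vertices.
  home : Fin k → Fin n → Bool
  home j a = does (c a ≟ j)

  vtx-level bar-level : Bool → ℕ
  vtx-level h = if h then 0 else 3
  bar-level h = if h then 1 else 2

  home-same : ∀ j {a b} → c a ≡ c b → home j a ≡ home j b
  home-same j = cong (λ i → does (i ≟ j))

  level : Fin k → Fin (n + n) → ℕ
  level j u = [ vtx-level ∘ home j , bar-level ∘ home j ]′ (splitAt n u)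

  level-vtx : ∀ j a → level j (vtx a) ≡ vtx-level (home j a)
  level-vtx j a = cong [ vtx-level ∘ home j , bar-level ∘ home j ]′ (splitAt-↑ˡ n a n)

  level-bar : ∀ j a → level j (bar a) ≡ bar-level (home j a)
  level-bar j a = cong [ vtx-level ∘ home j , bar-level ∘ home j ]′ (splitAt-↑ʳ n n a)

  level-lipschitz : ∀ j → Lipschitz (level j)
  level-lipschitz j {x} {y} edge with view x | view y
  ... | vtx-view a | vtx-view b rewrite level-vtx j a | level-vtx j b =
    ≤-trans (≤-reflexive (cong vtx-level (home-same j (sym (adjacent⇒same (trans (sym (A-vtx-vtx a b)) edge))))))
            (n≤1+n _)
  ... | vtx-view a | bar-view b rewrite level-vtx j a | level-bar j b
                               | ⌊≟⌋-sound (trans (sym (A-vtx-bar a b)) edge) = bar≤1+vtx (home j b)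
    where bar≤1+vtx : ∀ h → bar-level h ≤ suc (vtx-level h)
          bar≤1+vtx true  = ≤-refl
          bar≤1+vtx false = by-computation
  ... | bar-view a | vtx-view b rewrite level-bar j a | level-vtx j b
                               | ⌊≟⌋-sound (trans (sym (A-bar-vtx a b)) edge) = vtx≤1+bar (home j b)
    where vtx≤1+bar : ∀ h → vtx-level h ≤ suc (bar-level h)
          vtx≤1+bar true  = z≤n
          vtx≤1+bar false = ≤-refl
  ... | bar-view a | bar-view b rewrite level-bar j a | level-bar j b = bar≤1+bar (home j a) (home j b)
    where bar≤1+bar : ∀ h h′ → bar-level h′ ≤ suc (bar-level h)
          bar≤1+bar h true  = s≤s z≤n
          bar≤1+bar true  false = ≤-refl
          bar≤1+bar false false = n≤1+n 2

  far-vtx-vtx : ∀ {a b} → c a ≢ c b → DistAtLeast (vtx a) (vtx b) 3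
  far-vtx-vtx {a} {b} ca≢cb = subst (DistAtLeast (vtx a) (vtx b)) level-b≡3
    (lipschitz-dist (level-lipschitz (c a)) level-a≡0)
    where
      level-a≡0 : level (c a) (vtx a) ≡ 0
      level-a≡0 = trans (level-vtx (c a) a) (cong vtx-level (dec-true (c a ≟ c a) refl))
      level-b≡3 : level (c a) (vtx b) ≡ 3
      level-b≡3 = trans (level-vtx (c a) b) (cong vtx-level (dec-false (c b ≟ c a) (≢-sym ca≢cb)))

  vtx-off-bar-geodesic : ∀ {p q v} → OnGeodesic (bar p) (bar q) (vtx v) → ⊥
  vtx-off-bar-geodesic {p} {q} {v} geo with p ≟ v | q ≟ v
  ... | no p≢v | _ = off-geodesic {B = 2} {2} {1} geo (dist-bar-bar≤2 p q)
                       (dist≥2 (≢-sym vtx≢bar) (no-bar-vtx p≢v)) (dist≥1 vtx≢bar) by-computation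
  ... | yes refl | no q≢v = off-geodesic {B = 2} {1} {2} geo (dist-bar-bar≤2 p q)
                       (dist≥1 (≢-sym vtx≢bar)) (dist≥2 vtx≢bar (no-vtx-bar (≢-sym q≢v))) by-computation
  ... | yes refl | yes refl = vtx≢bar (trivial-geodesic geo)

  module ConvexSet (C : Subset (n + n)) (convex : Convex A C) where

    -- vtx p, bar p, bar q, vtx q is a geodesic when c p ≢ c q.
    bar-between : ∀ {p q} → vtx p ∈ C → vtx q ∈ C → c p ≢ c q → bar p ∈ C
    bar-between {p} {q} p∈C q∈C cp≢cq =
      convex-∋-geodesic convex p∈C q∈C
        (cons (rung p) (cons (bar-edge-across cp≢cq) (cons (rung⁻ q) nil)))
        (far-vtx-vtx cp≢cq) (onRest _ (onStart _))

    -- For an edge ab of G in component i, bar a, bar v, bar b is a geodesic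
    -- whenever v lies outside component i.
    bars-off-edge : ∀ {a b i} → bar a ∈ C → bar b ∈ C → adj G a b ≡ true → c a ≡ i →
                    ∀ v → c v ≢ i → bar v ∈ C
    bars-off-edge {a} {b} a∈C b∈C edge refl v cv≢ca =
      convex-∋-geodesic convex a∈C b∈C
        (cons (bar-edge-across (≢-sym cv≢ca)) (cons (bar-edge-across cv≢cb) nil))
        (dist≥2 (adjacent⇒distinct edge ∘ bar-injective) (no-bar-edge edge)) (onRest _ (onStart _))
      where cv≢cb : c v ≢ c b
            cv≢cb cv≡cb = cv≢ca (trans cv≡cb (sym (adjacent⇒same edge)))

    -- For an edge ab of G, bar b, vtx b, vtx a is a geodesic.
    vtx-step : ∀ {a b} → vtx a ∈ C → bar b ∈ C → adj G a b ≡ true → vtx b ∈ C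
    vtx-step {a} {b} a∈C b∈C edge =
      convex-∋-geodesic convex b∈C a∈C
        (cons (rung⁻ b) (cons (vtx-edge (trans (SimpleGraph.sym G b a) edge)) nil))
        (dist≥2 (≢-sym vtx≢bar) (no-bar-vtx (≢-sym (adjacent⇒distinct edge)))) (onRest _ (onStart _))

    spread : ∀ {a v ℓ} → vtx a ∈ C → (∀ u → bar u ∈ C) → Walk (adj G) a v ℓ → vtx v ∈ C
    spread a∈C bars nil           = a∈C
    spread a∈C bars (cons edge w) = spread (vtx-step a∈C (bars _) edge) bars w

  module UpperBound (i₁ i₂ : Fin k) (i₁≢i₂ : i₁ ≢ i₂)
                    (nt₁ : NontrivialComponent (adj G) c i₁)
                    (nt₂ : NontrivialComponent (adj G) c i₂) where

    generator : Fin (suc k) → Fin (n + n)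
    generator zero    = vtx (proj₁ (rep-neighbour nt₁))
    generator (suc j) = vtx (rep j)

    S₀ : Subset (n + n)
    S₀ = image generator

    ∣S₀∣≤1+k : ∣ S₀ ∣ ≤ suc k
    ∣S₀∣≤1+k = ∣image∣≤ generator

    S₀-hull : IsHullSet A S₀
    S₀-hull u C S₀⊆C convex = everything u
      where
        open ConvexSet C convex

        rep∈ : ∀ j → vtx (rep j) ∈ C
        rep∈ j = S₀⊆C (∈-image generator (suc j))

        w₁ w₂ : Fin n
        w₁ = proj₁ (rep-neighbour nt₁)
        w₂ = proj₁ (rep-neighbour nt₂)
        edge₁ : adj G (rep i₁) w₁ ≡ true
        edge₁ = proj₂ (rep-neighbour nt₁)
        edge₂ : adj G (rep i₂) w₂ ≡ true
        edge₂ = proj₂ (rep-neighbour nt₂)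

        -- Both ends of edge₁ get their bars from a vertex of another component.
        j′ : Fin k
        j′ = proj₁ (another-label two-components i₁)
        j′≢i₁ : j′ ≢ i₁
        j′≢i₁ = proj₂ (another-label two-components i₁)

        bars-outside₁ : ∀ v → c v ≢ i₁ → bar v ∈ C
        bars-outside₁ = bars-off-edge
          (bar-between (rep∈ i₁) (rep∈ j′) (labels-differ (rep-label i₁) (rep-label j′) (≢-sym j′≢i₁)))
          (bar-between (S₀⊆C (∈-image generator zero)) (rep∈ j′)
                       (labels-differ (neighbour-label edge₁) (rep-label j′) (≢-sym j′≢i₁)))
          edge₁ (rep-label i₁)

        -- The ends of edge₂ lie outside component i₁.
        bars-outside₂ : ∀ v → c v ≢ i₂ → bar v ∈ C
        bars-outside₂ = bars-off-edge
          (bars-outside₁ (rep i₂) (λ e → i₁≢i₂ (trans (sym e) (rep-label i₂))))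
          (bars-outside₁ w₂ (λ e → i₁≢i₂ (trans (sym e) (neighbour-label edge₂))))
          edge₂ (rep-label i₂)

        all-bars : ∀ v → bar v ∈ C
        all-bars v with c v ≟ i₁
        ... | yes cv≡i₁ = bars-outside₂ v (λ cv≡i₂ → i₁≢i₂ (trans (sym cv≡i₁) cv≡i₂))
        ... | no cv≢i₁  = bars-outside₁ v cv≢i₁

        everything : ∀ u → u ∈ C
        everything u with view u
        ... | vtx-view a = spread (rep∈ (c a)) all-bars (proj₂ (walk-from-rep a))
        ... | bar-view a = all-bars a

  outside? : (j : Fin k) → Decidable (λ a → c a ≢ j)
  outside? j a = ¬? (c a ≟ j)

  everywhere? : Decidable (λ (_ : Fin n) → ⊤)
  everywhere? _ = yes tt

  avoiding : Fin k → Subset (n + n)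
  avoiding j = prismSet (outside? j) everywhere?

  avoiding-convex : ∀ j → Convex A (avoiding j)
  avoiding-convex j = geodesically-closed⇒convex (avoiding j) closed
    where
      vtx-outside : ∀ {a} → vtx a ∈ avoiding j → c a ≢ j
      vtx-outside = vtx∈⁻ (outside? j) everywhere?

      -- A G-vertex of component j is far from the rest of G, and bars
      -- never route through G.
      blocked : ∀ {x y v} → x ∈ avoiding j → y ∈ avoiding j → c v ≡ j → OnGeodesic x y (vtx v) → ⊥
      blocked {x} {y} {v} x∈ y∈ cv≡j geo with view x | view y
      ... | vtx-view p | vtx-view q = off-geodesic {B = 3} {3} {1} geo (dist-vtx-vtx≤3 p q)
              (far-vtx-vtx (λ cp≡cv → vtx-outside x∈ (trans cp≡cv cv≡j)))
              (dist≥1 (vtx-≢ (different⇒distinct (λ cv≡cq → vtx-outside y∈ (trans (sym cv≡cq) cv≡j)))))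
              by-computation
      ... | vtx-view p | bar-view q = off-geodesic {B = 2} {3} {1} geo (dist-vtx-bar≤2 p q)
              (far-vtx-vtx (λ cp≡cv → vtx-outside x∈ (trans cp≡cv cv≡j)))
              (dist≥1 vtx≢bar) by-computation
      ... | bar-view p | vtx-view q = off-geodesic {B = 2} {1} {3} geo (dist-bar-vtx≤2 p q)
              (dist≥1 (≢-sym vtx≢bar))
              (far-vtx-vtx (λ cv≡cq → vtx-outside y∈ (trans (sym cv≡cq) cv≡j)))
              by-computation
      ... | bar-view p | bar-view q = vtx-off-bar-geodesic geo

      closed : ∀ {x y z} → x ∈ avoiding j → y ∈ avoiding j → OnGeodesic x y z → z ∈ avoiding j
      closed {z = z} x∈ y∈ geo with view z
      ... | bar-view v = bar∈⁺ (outside? j) everywhere? tt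
      ... | vtx-view v with c v ≟ j
      ...   | no cv≢j  = vtx∈⁺ (outside? j) everywhere? cv≢j
      ...   | yes cv≡j = ⊥-elim (blocked x∈ y∈ cv≡j geo)

  hull-meets-component : ∀ {S} → IsHullSet A S → ∀ j → ∃[ v ] vtx v ∈ S × c v ≡ j
  hull-meets-component {S} S-hull j with any? (λ v → (vtx v ∈? S) ×-dec (c v ≟ j))
  ... | yes found = found
  ... | no none   = ⊥-elim (vtx∈⁻ (outside? j) everywhere?
                      (S-hull (vtx (rep j)) (avoiding j) S⊆avoiding (avoiding-convex j)) (rep-label j))
    where
      S⊆avoiding : S ⊆ avoiding j
      S⊆avoiding {u} u∈S with view u
      ... | vtx-view a = vtx∈⁺ (outside? j) everywhere? (λ ca≡j → none (a , u∈S , ca≡j))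
      ... | bar-view a = bar∈⁺ (outside? j) everywhere? tt

  module LowerBound (S : Subset (n + n)) (S-hull : IsHullSet A S) where

    chosen : Fin k → Fin n
    chosen j = proj₁ (hull-meets-component S-hull j)

    chosen-∈ : ∀ j → vtx (chosen j) ∈ S
    chosen-∈ j = proj₁ (proj₂ (hull-meets-component S-hull j))

    chosen-label : ∀ j → c (chosen j) ≡ j
    chosen-label j = proj₂ (proj₂ (hull-meets-component S-hull j))

    chosen-injective : Injective _≡_ _≡_ chosen
    chosen-injective {i} {j} eq = trans (sym (chosen-label i)) (trans (cong c eq) (chosen-label j))

    Chosen : Fin n → Set
    Chosen a = chosen (c a) ≡ a

    Chosen? : Decidable Chosen
    Chosen? a = chosen (c a) ≟ a

    Chosen-apart : ∀ {p q} → Chosen p → Chosen q → p ≢ q → c p ≢ c q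
    Chosen-apart chosen-p chosen-q p≢q cp≡cq =
      p≢q (trans (sym chosen-p) (trans (cong chosen cp≡cq) chosen-q))

    U : Subset (n + n)
    U = prismSet Chosen? Chosen?

    vtx-chosen : ∀ {a} → vtx a ∈ U → Chosen a
    vtx-chosen = vtx∈⁻ Chosen? Chosen?

    bar-chosen : ∀ {a} → bar a ∈ U → Chosen a
    bar-chosen = bar∈⁻ Chosen? Chosen?

    vtx-unchosen : ∀ {a} → vtx a ∉ U → ¬ Chosen a
    vtx-unchosen a∉U = a∉U ∘ vtx∈⁺ Chosen? Chosen?

    bar-unchosen : ∀ {a} → bar a ∉ U → ¬ Chosen a
    bar-unchosen a∉U = a∉U ∘ bar∈⁺ Chosen? Chosen?

    apart : ∀ {p v} → Chosen p → ¬ Chosen v → v ≢ p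
    apart chosen-p unchosen-v refl = unchosen-v chosen-p

    -- A vertex outside U lies on no geodesic between distinct points of U:
    -- its distances to the two ends add up to more than their distance.
    off-U-geodesic : ∀ {x y z} → x ∈ U → y ∈ U → x ≢ y → z ∉ U → OnGeodesic x y z → ⊥
    off-U-geodesic {x} {y} {z} x∈ y∈ x≢y z∉ geo with view x | view y | view z
    ... | vtx-view p | vtx-view q | vtx-view v with c v ≟ c p
    ...   | no cv≢cp  = off-geodesic {B = 3} {3} {1} geo (dist-vtx-vtx≤3 p q)
          (far-vtx-vtx (≢-sym cv≢cp)) (dist≥1 (vtx-≢ (apart (vtx-chosen y∈) (vtx-unchosen z∉)))) by-computation
    ...   | yes cv≡cp = off-geodesic {B = 3} {1} {3} geo (dist-vtx-vtx≤3 p q)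
          (dist≥1 (vtx-≢ (≢-sym (apart (vtx-chosen x∈) (vtx-unchosen z∉)))))
          (far-vtx-vtx (λ cv≡cq → Chosen-apart (vtx-chosen x∈) (vtx-chosen y∈) (x≢y ∘ cong vtx)
                                                (trans (sym cv≡cp) cv≡cq)))
          by-computation
    off-U-geodesic x∈ y∈ x≢y z∉ geo | vtx-view p | vtx-view q | bar-view v =
      off-geodesic {B = 3} {2} {2} geo (dist-vtx-vtx≤3 p q)
        (dist≥2 vtx≢bar (no-vtx-bar (≢-sym (apart (vtx-chosen x∈) (bar-unchosen z∉)))))
        (dist≥2 (≢-sym vtx≢bar) (no-bar-vtx (apart (vtx-chosen y∈) (bar-unchosen z∉)))) by-computation
    off-U-geodesic x∈ y∈ x≢y z∉ geo | vtx-view p | bar-view q | vtx-view v =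
      off-geodesic {B = 2} {1} {2} geo (dist-vtx-bar≤2 p q)
        (dist≥1 (vtx-≢ (≢-sym (apart (vtx-chosen x∈) (vtx-unchosen z∉)))))
        (dist≥2 vtx≢bar (no-vtx-bar (apart (bar-chosen y∈) (vtx-unchosen z∉)))) by-computation
    off-U-geodesic x∈ y∈ x≢y z∉ geo | vtx-view p | bar-view q | bar-view v =
      off-geodesic {B = 2} {2} {1} geo (dist-vtx-bar≤2 p q)
        (dist≥2 vtx≢bar (no-vtx-bar (≢-sym (apart (vtx-chosen x∈) (bar-unchosen z∉)))))
        (dist≥1 (bar-≢ (apart (bar-chosen y∈) (bar-unchosen z∉)))) by-computation
    off-U-geodesic x∈ y∈ x≢y z∉ geo | bar-view p | vtx-view q | vtx-view v =
      off-geodesic {B = 2} {2} {1} geo (dist-bar-vtx≤2 p q)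
        (dist≥2 (≢-sym vtx≢bar) (no-bar-vtx (≢-sym (apart (bar-chosen x∈) (vtx-unchosen z∉)))))
        (dist≥1 (vtx-≢ (apart (vtx-chosen y∈) (vtx-unchosen z∉)))) by-computation
    off-U-geodesic x∈ y∈ x≢y z∉ geo | bar-view p | vtx-view q | bar-view v =
      off-geodesic {B = 2} {1} {2} geo (dist-bar-vtx≤2 p q)
        (dist≥1 (bar-≢ (≢-sym (apart (bar-chosen x∈) (bar-unchosen z∉)))))
        (dist≥2 (≢-sym vtx≢bar) (no-bar-vtx (apart (vtx-chosen y∈) (bar-unchosen z∉)))) by-computation
    off-U-geodesic x∈ y∈ x≢y z∉ geo | bar-view p | bar-view q | vtx-view v = vtx-off-bar-geodesic geo
    off-U-geodesic x∈ y∈ x≢y z∉ geo | bar-view p | bar-view q | bar-view v =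
      off-geodesic {B = 1} {1} {1} geo
        (1 , ≤-refl , cons (bar-edge-across (Chosen-apart (bar-chosen x∈) (bar-chosen y∈) (x≢y ∘ cong bar))) nil)
        (dist≥1 (bar-≢ (≢-sym (apart (bar-chosen x∈) (bar-unchosen z∉)))))
        (dist≥1 (bar-≢ (apart (bar-chosen y∈) (bar-unchosen z∉)))) by-computation

    U-convex : Convex A U
    U-convex = geodesically-closed⇒convex U closed
      where
        closed : ∀ {x y z} → x ∈ U → y ∈ U → OnGeodesic x y z → z ∈ U
        closed {x} {y} {z} x∈ y∈ geo with z ∈? U | x ≟ y
        ... | yes z∈ | _        = z∈
        ... | no z∉  | yes refl = ⊥-elim (z∉ (subst (_∈ U) (sym (trivial-geodesic geo)) x∈))
        ... | no z∉  | no x≢y   = ⊥-elim (off-U-geodesic x∈ y∈ x≢y z∉ geo)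

    -- S contains the k chosen vertices and, since U is a convex set missing
    -- a vertex of a nontrivial component, at least one more vertex.
    ∣S∣≥1+k : ∀ {i} → NontrivialComponent (adj G) c i → suc k ≤ ∣ S ∣
    ∣S∣≥1+k {i} (x , y , x≢y , cx≡i , cy≡i)
      with any? (λ z → (z ∈? S) ×-dec ¬? (any? (λ j → vtx (chosen j) ≟ z)))
    ... | yes (z , z∈S , z-new) = injective⇒≤∣∣ family family-injective S family-∈
      where
        family : Fin (suc k) → Fin (n + n)
        family zero    = z
        family (suc j) = vtx (chosen j)

        family-injective : Injective _≡_ _≡_ family
        family-injective {zero}  {zero}  _  = refl
        family-injective {zero}  {suc j} eq = ⊥-elim (z-new (j , sym eq))
        family-injective {suc i} {zero}  eq = ⊥-elim (z-new (i , eq))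
        family-injective {suc i} {suc j} eq = cong suc (chosen-injective (vtx-injective eq))

        family-∈ : ∀ j → family j ∈ S
        family-∈ zero    = z∈S
        family-∈ (suc j) = chosen-∈ j
    ... | no no-extra = ⊥-elim (x≢y x≡y)
      where
        S⊆U : S ⊆ U
        S⊆U {z} z∈S with any? (λ j → vtx (chosen j) ≟ z)
        ... | yes (j , refl) = vtx∈⁺ Chosen? Chosen? (cong chosen (chosen-label j))
        ... | no z-new       = ⊥-elim (no-extra (z , z∈S , z-new))

        everything-chosen : ∀ a → Chosen a
        everything-chosen a = vtx-chosen (S-hull (vtx a) U S⊆U U-convex)

        x≡y : x ≡ y
        x≡y = trans (sym (everything-chosen x)) (trans (cong chosen (trans cx≡i (sym cy≡i))) (everything-chosen y))

theorem3 : ∀ (n : ℕ) (G : SimpleGraph n) (k : ℕ) (c : Fin n → Fin k) →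
           IsComponentLabelling (adj G) c → 2 ≤ k →
           (∃[ i ] ∃[ j ] (¬ i ≡ j × NontrivialComponent (adj G) c i × NontrivialComponent (adj G) c j)) →
           HullNumber (prismAdj G) (suc k)
-- S₀ is a hull set of size ≤ k + 1 and every hull set has size ≥ k + 1.
theorem3 n G k c labelling two-components (i₁ , i₂ , i₁≢i₂ , nt₁ , nt₂) =
  (S₀ , S₀-hull , ≤-antisym ∣S₀∣≤1+k (hull-set-size S₀ S₀-hull)) , hull-set-size
  where
    open Disconnected G c labelling two-components
    open UpperBound i₁ i₂ i₁≢i₂ nt₁ nt₂

    hull-set-size : ∀ S → IsHullSet (prismAdj G) S → suc k ≤ ∣ S ∣
    hull-set-size S S-hull = LowerBound.∣S∣≥1+k S S-hull nt₁
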